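{- For partial orders $\langle R,X\rangle$ and $\langle S,Y\rangle$ with $X\cap Y=\emptyset$, $P(\langle R,X\rangle\cdot\langle S,Y\rangle)=P\langle R,X\rangle\cdot P\langle S,Y\rangle$, where the $\cdot$ on the right is the (partial-order) concatenation product of relationships.
   Context: A relation is a pair $\langle R,X\rangle$ with $R\subseteq X^2$; partial orders are strict (irreflexive and transitive). For $X\cap Y=\emptyset$, $\langle R,X\rangle\cdot\langle S,Y\rangle=\langle R\cup S\cup(X\times Y),X\cup Y\rangle$. A relationship on $X$ is a pair $[U,X]$ with $U\subseteq\mathcal P(X^2)$. For a partial order, $P\langle R,X\rangle=[\{R'\subseteq X^2\mid R\subseteq R',\ \langle R',X\rangle\text{ a partial order}\},X]$. For relationships $[U,X],[V,Y]$ with $X\cap Y=\emptyset$, the concatenation product is $[U,X]\cdot[V,Y]=[\{Q\subseteq(X\cup Y)^2\mid\langle Q,X\cup Y\rangle\text{ a partial order and }\exists R\in U\,\exists S\in V\ \langle Q,X\cup Y\rangle=\langle R,X\rangle\cdot\langle S,Y\rangle\},X\cup Y]$. -}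

module Defs where

open import Level using (Lift; lift; 0ℓ) renaming (suc to lsuc)
open import Data.Product using (Σ; _×_; _,_)
open import Data.Sum using (_⊎_)
open import Data.Empty using (⊥)
open import Relation.Nullary using (¬_)

-- All sets are subsets (predicates) of an ambient universe A : Set.
Subset : Set → Set₁
Subset A = A → Set

BinRel : Set → Set₁
BinRel A = A → A → Set

_∪_ : {A : Set} → Subset A → Subset A → Subset A
(X ∪ Y) a = X a ⊎ Y a

Disjoint : {A : Set} → Subset A → Subset A → Set
Disjoint {A} X Y = (a : A) → X a → Y a → ⊥

IsRelOn : {A : Set} → BinRel A → Subset A → Set
IsRelOn {A} R X = (a b : A) → R a b → X a × X b

IsPartialOrder : {A : Set} → BinRel A → Subset A → Set
IsPartialOrder {A} R X =
  IsRelOn R X × ((a : A) → ¬ R a a) × ((a b c : A) → R a b → R b c → R a c)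

_⊆ᵣ_ : {A : Set} → BinRel A → BinRel A → Set
_⊆ᵣ_ {A} R R' = (a b : A) → R a b → R' a b

_≐_ : {A : Set} → BinRel A → BinRel A → Set
R ≐ R' = (R ⊆ᵣ R') × (R' ⊆ᵣ R)

_≐ₛ_ : {A : Set} → Subset A → Subset A → Set
_≐ₛ_ {A} X Y = ((a : A) → X a → Y a) × ((a : A) → Y a → X a)

-- Relation product ⟨R,X⟩·⟨S,Y⟩ = ⟨R ∪ S ∪ (X × Y), X ∪ Y⟩ : the relation component
-- (the carrier component is X ∪ Y)
concatRel : {A : Set} → BinRel A → Subset A → BinRel A → Subset A → BinRel A
concatRel R X S Y a b = R a b ⊎ S a b ⊎ (X a × Y b)

record Relationship (A : Set) : Set₂ where
  constructor [_,_]
  field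
    fam     : BinRel A → Set₁
    carrier : Subset A
open Relationship public

_≋_ : {A : Set} → Relationship A → Relationship A → Set₁
_≋_ {A} 𝓤 𝓥 =
  (carrier 𝓤 ≐ₛ carrier 𝓥) ×
  ((Q : BinRel A) → (fam 𝓤 Q → fam 𝓥 Q) × (fam 𝓥 Q → fam 𝓤 Q))

-- P⟨R,X⟩ = [{R' ⊆ X² | R ⊆ R', ⟨R',X⟩ partial order}, X]
-- (R' ⊆ X² is part of IsPartialOrder R' X)
P : {A : Set} → BinRel A → Subset A → Relationship A
P R X = [ (λ R' → Lift (lsuc 0ℓ) ((R ⊆ᵣ R') × IsPartialOrder R' X)) , X ]

_·_ : {A : Set} → Relationship A → Relationship A → Relationship A
_·_ {A} 𝓤 𝓥 =
  [ (λ Q → Lift (lsuc 0ℓ) (IsPartialOrder Q (carrier 𝓤 ∪ carrier 𝓥))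
         × Σ (BinRel A) (λ R → fam 𝓤 R × Σ (BinRel A) (λ S → fam 𝓥 S
             × Lift (lsuc 0ℓ) (Q ≐ concatRel R (carrier 𝓤) S (carrier 𝓥)))))
  , carrier 𝓤 ∪ carrier 𝓥 ]

module Submission where

-- Both relationships have carrier X ∪ Y, so only the families
-- have to be compared.
--   (⊆) A partial order Q on X ∪ Y extending R ∪ S ∪ (X × Y) is the
--       concatenation of its restrictions Q|X and Q|Y: these are partial
--       orders extending R and S, and Q has no pair from Y to X, since
--       together with the pair back from X × Y it would give a cycle.
--   (⊇) If Q = R' ∪ S' ∪ (X × Y) with R ⊆ R' and S ⊆ S', then Q contains
--       R ∪ S ∪ (X × Y) because concatenation is monotone.

open import Defs
open import Level using (lift)
open import Data.Product using (_×_; _,_)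
open import Data.Sum using (inj₁; inj₂)
open import Data.Empty using (⊥-elim)
open import Relation.Nullary using (¬_)

restrict : {A : Set} → BinRel A → Subset A → BinRel A
restrict Q X a b = Q a b × X a × X b

restrict-isPartialOrder : {A : Set} (Q : BinRel A) {Z : Subset A} (X : Subset A) →
  IsPartialOrder Q Z → IsPartialOrder (restrict Q X) X
restrict-isPartialOrder {A} Q X (_ , irrQ , transQ) = onX , irr , trans
  where
  onX : IsRelOn (restrict Q X) X
  onX a b (_ , xa , xb) = xa , xb
  irr : (a : A) → ¬ restrict Q X a a
  irr a (q , _) = irrQ a q
  trans : (a b c : A) → restrict Q X a b → restrict Q X b c → restrict Q X a c
  trans a b c (q , xa , _) (q′ , _ , xc) = transQ a b c q q′ , xa , xc

restrict-extends : {A : Set} {R Q : BinRel A} {X : Subset A} →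
  IsRelOn R X → R ⊆ᵣ Q → R ⊆ᵣ restrict Q X
restrict-extends onX R⊆Q a b r = R⊆Q a b r , onX a b r

concat-decomposition : {A : Set} (Q : BinRel A) (X Y : Subset A) →
  IsPartialOrder Q (X ∪ Y) → (∀ a b → X a → Y b → Q a b) →
  Q ≐ concatRel (restrict Q X) X (restrict Q Y) Y
concat-decomposition Q X Y (onXY , irrQ , transQ) X×Y⊆Q = split , join
  where
  split : Q ⊆ᵣ concatRel (restrict Q X) X (restrict Q Y) Y
  split a b q with onXY a b q
  ... | inj₁ xa , inj₁ xb = inj₁ (q , xa , xb)
  ... | inj₂ ya , inj₂ yb = inj₂ (inj₁ (q , ya , yb))
  ... | inj₁ xa , inj₂ yb = inj₂ (inj₂ (xa , yb))
  ... | inj₂ ya , inj₁ xb =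
    ⊥-elim (irrQ a (transQ a b a q (X×Y⊆Q b a xb ya)))
  join : concatRel (restrict Q X) X (restrict Q Y) Y ⊆ᵣ Q
  join a b (inj₁ (q , _))          = q
  join a b (inj₂ (inj₁ (q , _)))   = q
  join a b (inj₂ (inj₂ (xa , yb))) = X×Y⊆Q a b xa yb

concat-mono : {A : Set} {R R′ S S′ : BinRel A} {X Y : Subset A} →
  R ⊆ᵣ R′ → S ⊆ᵣ S′ → concatRel R X S Y ⊆ᵣ concatRel R′ X S′ Y
concat-mono R⊆R′ _ a b (inj₁ r)          = inj₁ (R⊆R′ a b r)
concat-mono _ S⊆S′ a b (inj₂ (inj₁ s))   = inj₂ (inj₁ (S⊆S′ a b s))
concat-mono _ _    a b (inj₂ (inj₂ x×y)) = inj₂ (inj₂ x×y)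

proposition4p3 : {A : Set} (R : BinRel A) (X : Subset A) (S : BinRel A) (Y : Subset A) →
    IsPartialOrder R X → IsPartialOrder S Y → Disjoint X Y →
    P (concatRel R X S Y) (X ∪ Y) ≋ (P R X · P S Y)
proposition4p3 {A} R X S Y (onR , _) (onS , _) _ =
  ((λ _ z → z) , (λ _ z → z)) , λ Q → extension⇒product Q , product⇒extension Q
  where
  extension⇒product : (Q : BinRel A) → fam (P (concatRel R X S Y) (X ∪ Y)) Q →
                      fam (P R X · P S Y) Q
  extension⇒product Q (lift (ext , poQ)) =
    lift poQ ,
    restrict Q X , lift (restrict-extends onR (λ a b r → ext a b (inj₁ r)) ,
                         restrict-isPartialOrder Q X poQ) ,
    restrict Q Y , lift (restrict-extends onS (λ a b s → ext a b (inj₂ (inj₁ s))) ,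
                         restrict-isPartialOrder Q Y poQ) ,
    lift (concat-decomposition Q X Y poQ (λ a b xa yb → ext a b (inj₂ (inj₂ (xa , yb)))))

  product⇒extension : (Q : BinRel A) → fam (P R X · P S Y) Q →
                      fam (P (concatRel R X S Y) (X ∪ Y)) Q
  product⇒extension Q (lift poQ , _ , lift (R⊆R′ , _) , _ , lift (S⊆S′ , _) , lift (_ , join)) =
    lift ((λ a b p → join a b (concat-mono {X = X} {Y = Y} R⊆R′ S⊆S′ a b p)) , poQ)
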